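{- Let $P$ be a $\pi$-term whose free names lie in the finite set $\mathcal X=\{x_1,\dots,x_k\}$, and let $\Gamma_{\mathcal X}$ be the environment $x_1:W,\dots,x_k:W$. Then $\Gamma_{\mathcal X}\vdash [\![P]\!]$.
   Context: $\pi$-terms: $P ::= 0 \mid u(x).P \mid \overline{u}\langle x\rangle.P \mid (P\mid P) \mid (\nu x)P$, where $u(x).P$ and $(\nu x)P$ bind $x$ in $P$. Triadic solos terms: $P ::= 0 \mid u(x_1x_2x_3) \mid \overline{u}\langle x_1x_2x_3\rangle \mid (P\mid P) \mid (\nu x)P$ ($(\nu x)P$ binds $x$). Typed terms: restrictions carry a type $U\in\{V,W\}$, written $(\nu x^U)P$. An environment $\Gamma$ is a finite map from names to $\{V,W\}$; $\Gamma,x:U$ its extension by a fresh name. $\Gamma\vdash P$ is derived by: $\Gamma\vdash 0$; from $\Gamma\vdash P$ and $\Gamma\vdash Q$ infer $\Gamma\vdash P\mid Q$; from $\Gamma,x:U\vdash P$ infer $\Gamma\vdash(\nu x^U)P$; a solo (input or output) with subject $u$ and objects $a,b,c$ is typed by $\Gamma$ iff $\Gamma$ is defined on $u,a,b,c$ and $(\Gamma(u),\Gamma(a),\Gamma(b),\Gamma(c))\in\{(V,W,W,V),(W,W,V,V)\}$. Translation (with fresh names $w,y,z,v'$ each time): $C(v) := (\nu z^W)\, v(zzv)$; $[\![0]\!]_v:=0$; $[\![u(x).P]\!]_v := (\nu w^W)(\nu y^V)(\overline v\langle uwy\rangle \mid C(y) \mid (\nu x^W)(\nu v'^V)(w(xvv')\mid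 [\![P]\!]_{v'}))$; $[\![\overline u\langle x\rangle.P]\!]_v := (\nu w^W)(\nu y^V)(\overline v\langle uwy\rangle \mid C(y) \mid (\nu v'^V)(\overline w\langle xv'v\rangle\mid [\![P]\!]_{v'}))$; $[\![P\mid Q]\!]_v := [\![P]\!]_v\mid[\![Q]\!]_v$; $[\![(\nu x)P]\!]_v := (\nu x^W)[\![P]\!]_v$; $[\![P]\!] := (\nu v^V)([\![P]\!]_v\mid C(v))$. -}

module Defs where

open import Data.Nat using (ℕ; zero; suc)
open import Data.Fin using (Fin; zero; suc)
open import Data.Vec using (Vec; _∷_; lookup; replicate)

-- Well-scoped (de Bruijn) syntax: a term of type `Pi n` has its free names
-- among the n names `Fin n`; index `zero` is the most recently bound name.

data Pi (n : ℕ) : Set where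
  nil : Pi n
  inp : Fin n → Pi (suc n) → Pi n
  out : Fin n → Fin n → Pi n → Pi n        -- ū⟨x⟩.P
  par : Pi n → Pi n → Pi n
  nu  : Pi (suc n) → Pi n

data Ty : Set where
  V W : Ty

data Solo (n : ℕ) : Set where
  nil   : Solo n
  isolo : Fin n → Fin n → Fin n → Fin n → Solo n   -- u(x₁x₂x₃)
  osolo : Fin n → Fin n → Fin n → Fin n → Solo n   -- ū⟨x₁x₂x₃⟩
  par   : Solo n → Solo n → Solo n
  nu    : Ty → Solo (suc n) → Solo n

-- Environments: Γ assigns a type to each name in scope; Γ , x:U is U ∷ Γ
Env : ℕ → Set
Env n = Vec Ty n

-- Admissible sortings of a solo (subject, object1, object2, object3)
data SoloOK : Ty → Ty → Ty → Ty → Set where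
  okV : SoloOK V W W V
  okW : SoloOK W W V V

data _⊢_ {n : ℕ} (Γ : Env n) : Solo n → Set where
  t-nil : Γ ⊢ nil
  t-par : ∀ {P Q} → Γ ⊢ P → Γ ⊢ Q → Γ ⊢ par P Q
  t-nu  : ∀ {U P} → (U ∷ Γ) ⊢ P → Γ ⊢ nu U P
  t-in  : ∀ {u a b c} → SoloOK (lookup Γ u) (lookup Γ a) (lookup Γ b) (lookup Γ c)
        → Γ ⊢ isolo u a b c
  t-out : ∀ {u a b c} → SoloOK (lookup Γ u) (lookup Γ a) (lookup Γ b) (lookup Γ c)
        → Γ ⊢ osolo u a b c

-- C(v) := (νz^W) v(z z v)
C : ∀ {m} → Fin m → Solo m
C v = nu W (isolo (suc v) zero zero (suc v))

-- ⟦P⟧_v.  ρ maps the free names of P into the target scope (renaming),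
-- v is the name parameter.  Fresh names are realised by the binders.
trans : ∀ {n m} → Pi n → (Fin n → Fin m) → Fin m → Solo m
trans nil ρ v = nil
-- (νw^W)(νy^V)( v̄⟨u w y⟩ | C(y) | (νx^W)(νv'^V)( w(x v v') | ⟦P⟧_{v'} ) )
-- scope after νw νy : y = 0, w = 1 ; after νx νv' : v' = 0, x = 1, y = 2, w = 3
trans {n} {m} (inp u P) ρ v =
  nu W (nu V
    (par (osolo (suc (suc v)) (suc (suc (ρ u))) (suc zero) zero)
    (par (C zero)
         (nu W (nu V
           (par (isolo (suc (suc (suc zero))) (suc zero) (suc (suc (suc (suc v)))) zero)
                (trans P ρ' zero)))))))
  where
  ρ' : Fin (suc n) → Fin (suc (suc (suc (suc m))))
  ρ' zero = suc zero
  ρ' (suc i) = suc (suc (suc (suc (ρ i))))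
-- (νw^W)(νy^V)( v̄⟨u w y⟩ | C(y) | (νv'^V)( w̄⟨x v' v⟩ | ⟦P⟧_{v'} ) )
-- scope after νw νy νv' : v' = 0, y = 1, w = 2
trans (out u x P) ρ v =
  nu W (nu V
    (par (osolo (suc (suc v)) (suc (suc (ρ u))) (suc zero) zero)
    (par (C zero)
         (nu V
           (par (osolo (suc (suc zero)) (suc (suc (suc (ρ x)))) zero (suc (suc (suc v))))
                (trans P (λ i → suc (suc (suc (ρ i)))) zero))))))
trans (par P Q) ρ v = par (trans P ρ v) (trans Q ρ v)
trans {n} {m} (nu P) ρ v = nu W (trans P ρ' (suc v))
  where
  ρ' : Fin (suc n) → Fin (suc m)
  ρ' zero = zero
  ρ' (suc i) = suc (ρ i)

-- ⟦P⟧ := (νv^V)(⟦P⟧_v | C(v))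
⟦_⟧ : ∀ {k} → Pi k → Solo k
⟦ P ⟧ = nu V (par (trans P suc zero) (C zero))

ΓW : (k : ℕ) → Env k
ΓW k = replicate k W

module Submission where

-- The encoding ⟦P⟧_v is typed under any environment Γ in which
-- the name parameter v has type V and every free name of P (seen through the
-- renaming ρ into Γ) has type W.  This invariant is proved by induction on P:
-- each encoding clause introduces its fresh names with exactly the types that
-- make its solos fit one of the two admissible sortings (V,W,W,V) and
-- (W,W,V,V) — w : W, y : V, v' : V — and every continuation ⟦P'⟧_{v'} is
-- called again with a V-typed parameter and a renaming into W-typed names.
-- Names bound by P itself (input objects, restrictions) become W-names of the
-- encoding, so the invariant extends along binders.

open import Data.Nat using (ℕ; suc)
open import Data.Fin using (Fin; zero; suc)
open import Data.Vec using (_∷_; lookup)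
open import Data.Vec.Properties using (lookup-replicate)
open import Relation.Binary.PropositionalEquality using (_≡_; refl)
open import Defs

-- A renaming ρ of the free names of a π-term into Γ is a W-renaming when all
-- its images are W-typed: this is how free π-names are sorted in ⟦P⟧.
-- (A record rather than a bare Π-type, so that ρ can be inferred from it.)
record WRenaming {n m : ℕ} (Γ : Env m) (ρ : Fin n → Fin m) : Set where
  constructor wRenaming
  field imageW : ∀ i → lookup Γ (ρ i) ≡ W
open WRenaming

extendW : ∀ {n m} {Γ : Env m} {ρ' : Fin (suc n) → Fin m} →
          lookup Γ (ρ' zero) ≡ W → (∀ i → lookup Γ (ρ' (suc i)) ≡ W) →
          WRenaming Γ ρ'
extendW newW oldW = wRenaming λ { zero → newW ; (suc i) → oldW i }

-- The two admissible sortings, stated up to equations on the looked-up types,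
-- so they can be applied directly to hypotheses about Γ.
sortV : ∀ {a b c d} → a ≡ V → b ≡ W → c ≡ W → d ≡ V → SoloOK a b c d
sortV refl refl refl refl = okV

sortW : ∀ {a b c d} → a ≡ W → b ≡ W → c ≡ V → d ≡ V → SoloOK a b c d
sortW refl refl refl refl = okW

C-typed : ∀ {m} (Γ : Env m) (v : Fin m) → lookup Γ v ≡ V → Γ ⊢ C v
C-typed Γ v hv = t-nu (t-in (sortV hv refl refl hv))

-- In the prefix clauses the fresh names are
-- w : W, y : V (for v̄⟨u w y⟩ and C(y)) and v' : V (the continuation
-- parameter); the solo on w is w(x v v') resp. w̄⟨x v' v⟩, sorted (W,W,V,V).
trans-typed : ∀ {n m} (P : Pi n) (Γ : Env m) (ρ : Fin n → Fin m) (v : Fin m) →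
              WRenaming Γ ρ → lookup Γ v ≡ V → Γ ⊢ trans P ρ v
trans-typed nil Γ ρ v hρ hv = t-nil
trans-typed (inp u P) Γ ρ v hρ hv =
  t-nu (t-nu (t-par (t-out (sortV hv (imageW hρ u) refl refl))
    (t-par (C-typed _ zero refl)
      (t-nu (t-nu (t-par (t-in (sortW refl refl hv refl))
        (trans-typed P _ _ zero (extendW refl (imageW hρ)) refl)))))))
trans-typed (out u x P) Γ ρ v hρ hv =
  t-nu (t-nu (t-par (t-out (sortV hv (imageW hρ u) refl refl))
    (t-par (C-typed _ zero refl)
      (t-nu (t-par (t-out (sortW refl (imageW hρ x) refl hv))
        (trans-typed P _ _ zero (wRenaming (imageW hρ)) refl))))))
trans-typed (par P Q) Γ ρ v hρ hv =
  t-par (trans-typed P Γ ρ v hρ hv) (trans-typed Q Γ ρ v hρ hv)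
trans-typed (nu P) Γ ρ v hρ hv =
  t-nu (trans-typed P _ _ (suc v) (extendW refl (imageW hρ)) hv)

-- Proposition 5.5: ⟦P⟧ = (νv^V)(⟦P⟧_v | C(v)) is typed by Γ_X.  Under the
-- binder v : V, the free names x_i (reached by suc) all have type W.
proposition5p5 : (k : ℕ) (P : Pi k) → ΓW k ⊢ ⟦ P ⟧
proposition5p5 k P =
  t-nu (t-par (trans-typed P (V ∷ ΓW k) suc zero freeNamesW refl)
              (C-typed (V ∷ ΓW k) zero refl))
  where
  freeNamesW : WRenaming (V ∷ ΓW k) suc
  freeNamesW = wRenaming λ i → lookup-replicate i W
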